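{- Let $I$ be an instance of Min d-VP with items $a_1,\ldots,a_n$. Suppose that for every dimension $i\in\{1,\ldots,d\}$ the Min BP instance $I_i$ has an equivalent graph $G_i=(V,E_i)$, where $V=\{v_1,\ldots,v_n\}$ and $v_j$ corresponds to item $a_j$. Let $G=(V,E_1\cup\cdots\cup E_d)$. Then $\mathrm{OPT}(I)\ge\omega(G)$.
   Context: Min d-VP: an instance consists of $n$ items $a_1,\ldots,a_n$, a number $d$ of dimensions and $n$ bins. Each item $a_j$ has a size vector $(s_{1,j},\ldots,s_{d,j})$ of positive rationals. A set of items fits into a bin if each component of the sum of their size vectors is at most $1$. The task is to find $n$ pairwise disjoint (possibly empty) subsets of the items, covering all items, such that each subset fits into a bin and the number of non-empty subsets is minimized. $\mathrm{OPT}(I)$ is this minimum. For dimension $i$, $I_i$ is the Min BP instance with items $a_1,\ldots,a_n$ and sizes $s_{i,1},\ldots,s_{i,n}$. A Min BP instance with sizes $s_1,\ldots,s_n$ and a graph $H$ are equivalent if there is a bijection $f$ from the items to the vertices of $H$ such that for every item subset $A'$ the characteristic vector $(x_1,\ldots,x_n)$ of $A'$ satisfies $s_1x_1+\cdots+s_nx_n\le1$ if and only if $f(A')$ is independent in $H$. $\omega(G)$ is the size of a largest clique of $G$. -}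

module Defs where

open import Data.Nat using (ℕ; zero; suc)
open import Data.Bool using (Bool; true; false; if_then_else_)
open import Data.Fin using (Fin; zero; suc)
open import Data.Fin.Properties using (any?) renaming (_≟_ to _≟F_)
open import Data.Fin.Subset using (Subset; _∈_; ∣_∣)
open import Data.Vec using (tabulate)
open import Data.Rational using (ℚ; 0ℚ; 1ℚ; _+_; _≤_; _<_)
open import Data.Product using (Σ; _,_; _×_; ∃; ∃-syntax)
open import Relation.Binary.PropositionalEquality using (_≡_; _≢_)
open import Relation.Nullary using (¬_)
open import Relation.Nullary.Decidable using (isYes)
open import Function.Bundles using (_⇔_)

Σℚ : (n : ℕ) → (Fin n → ℚ) → ℚ
Σℚ zero    f = 0ℚ
Σℚ (suc n) f = f zero + Σℚ n (λ j → f (suc j))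

record VPInstance (n d : ℕ) : Set where
  field
    size     : Fin d → Fin n → ℚ
    size-pos : ∀ i j → 0ℚ < size i j

subsetSum : {n : ℕ} → (Fin n → ℚ) → Subset n → ℚ
subsetSum {n} s A = Σℚ n (λ j → if Data.Vec.lookup A j then s j else 0ℚ)

-- A packing into the n bins: item j goes into bin (σ j).  Bin k contains {j | σ j ≡ k}.
-- (This is exactly a family of n pairwise disjoint subsets covering all items.)
Packing : ℕ → Set
Packing n = Fin n → Fin n

binContent : {n : ℕ} → Packing n → Fin n → Subset n
binContent σ k = tabulate (λ j → isYes (σ j ≟F k))

Feasible : {n d : ℕ} → VPInstance n d → Packing n → Set
Feasible {n} {d} I σ = ∀ (k : Fin n) (i : Fin d) →
  subsetSum (VPInstance.size I i) (binContent σ k) ≤ 1ℚ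

usedBins : {n : ℕ} → Packing n → Subset n
usedBins {n} σ = tabulate (λ k → isYes (any? (λ j → σ j ≟F k)))

numBins : {n : ℕ} → Packing n → ℕ
numBins σ = ∣ usedBins σ ∣

IsOPT : {n d : ℕ} → VPInstance n d → ℕ → Set
IsOPT I m = (∃[ σ ] (Feasible I σ × numBins σ ≡ m))
          × (∀ σ → Feasible I σ → m Data.Nat.≤ numBins σ)

record Graph (n : ℕ) : Set₁ where
  field
    Edge     : Fin n → Fin n → Set
    sym      : ∀ {u v} → Edge u v → Edge v u
    irrefl   : ∀ {u} → ¬ Edge u u

Independent : {n : ℕ} → Graph n → Subset n → Set
Independent H A = ∀ {u v} → u ∈ A → v ∈ A → ¬ Graph.Edge H u v

IsClique : {n : ℕ} → Graph n → Subset n → Set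
IsClique H K = ∀ {u v} → u ∈ K → v ∈ K → u ≢ v → Graph.Edge H u v

IsCliqueNumber : {n : ℕ} → Graph n → ℕ → Set
IsCliqueNumber H w = (∃[ K ] (IsClique H K × ∣ K ∣ ≡ w))
                   × (∀ K → IsClique H K → ∣ K ∣ Data.Nat.≤ w)

-- A Min BP instance with sizes s is equivalent to H, where item a_j corresponds to
-- vertex v_j (so the bijection f is the identity on Fin n).
Equivalent : {n : ℕ} → (Fin n → ℚ) → Graph n → Set
Equivalent {n} s H = ∀ (A : Subset n) → (subsetSum s A ≤ 1ℚ) ⇔ Independent H A

unionGraph : {n d : ℕ} → (Fin d → Graph n) → Graph n
unionGraph {n} {d} Gs = record
  { Edge   = λ u v → ∃[ i ] Graph.Edge (Gs i) u v
  ; sym    = λ { (i , e) → i , Graph.sym (Gs i) e }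
  ; irrefl = λ { (i , e) → Graph.irrefl (Gs i) e }
  }

module Submission where

-- Fix an optimal feasible packing σ and a maximum clique K of the
-- union graph G.  Every bin of σ fits, so by the equivalences it is independent
-- in each G_i, hence independent in G.  A clique and an independent set share
-- at most one vertex, so the items of K land in pairwise distinct bins: σ is
-- injective on K.  Since σ maps every item to a used bin, the pigeonhole
-- principle for subsets gives  ω(G) = ∣K∣ ≤ #used bins = OPT(I).

open import Defs
open import Data.Nat using (ℕ; _≤_; z≤n; s≤s)
open import Data.Nat.Properties using (≤-trans)
open import Data.Fin using (Fin; zero; suc)
open import Data.Fin.Properties using (suc-injective; 0≢1+n; any?) renaming (_≟_ to _≟F_)
open import Data.Fin.Subset using (Subset; _∈_; ∣_∣; _-_; inside; outside)
open import Data.Fin.Subset.Properties using (x∈p∧x≢y⇒x∈p-y; x∈p⇒∣p-x∣<∣p∣)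
open import Data.Vec using ([]; _∷_; here; there; tabulate)
open import Data.Vec.Properties using (lookup⇒[]=; lookup∘tabulate)
open import Data.Product using (_,_)
open import Data.Empty using (⊥-elim)
open import Relation.Nullary using (Dec; yes; no)
open import Relation.Nullary.Decidable using (isYes; isYes≗does; dec-true)
open import Relation.Binary.PropositionalEquality using (_≡_; refl; sym; trans; subst; subst₂)
open import Function using (_∘_)
open import Function.Bundles using (Equivalence)

InjectiveOn : {n m : ℕ} → (Fin n → Fin m) → Subset n → Set
InjectiveOn f K = ∀ {x y} → x ∈ K → y ∈ K → f x ≡ f y → x ≡ y

-- Induction on K; the image of a member of K is
-- removed from U so that the remaining members still land in U.
pigeonhole : {n m : ℕ} (K : Subset n) (U : Subset m) (f : Fin n → Fin m) →
  (∀ {x} → x ∈ K → f x ∈ U) → InjectiveOn f K → ∣ K ∣ ≤ ∣ U ∣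
pigeonhole []            U f maps inj = z≤n
pigeonhole (outside ∷ K) U f maps inj =
  pigeonhole K U (f ∘ suc) (maps ∘ there) (λ x y e → suc-injective (inj (there x) (there y) e))
pigeonhole (inside ∷ K)  U f maps inj =
  ≤-trans (s≤s (pigeonhole K (U - f zero) (f ∘ suc) mapsRest injRest))
          (x∈p⇒∣p-x∣<∣p∣ (maps here))
  where
  mapsRest : ∀ {x} → x ∈ K → f (suc x) ∈ U - f zero
  mapsRest x = x∈p∧x≢y⇒x∈p-y (maps (there x)) (λ e → 0≢1+n (inj here (there x) (sym e)))

  injRest : InjectiveOn (f ∘ suc) K
  injRest x y e = suc-injective (inj (there x) (there y) e)

∈-tabulate : {n : ℕ} {P : Fin n → Set} (P? : ∀ j → Dec (P j)) {j : Fin n} →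
  P j → j ∈ tabulate (λ k → isYes (P? k))
∈-tabulate P? {j} p =
  lookup⇒[]= j _ (trans (lookup∘tabulate _ j) (trans (isYes≗does (P? j)) (dec-true (P? j) p)))

∈-ownBin : {n : ℕ} (σ : Packing n) (u : Fin n) → u ∈ binContent σ (σ u)
∈-ownBin σ u = ∈-tabulate (λ j → σ j ≟F σ u) refl

ownBin-used : {n : ℕ} (σ : Packing n) (u : Fin n) → σ u ∈ usedBins σ
ownBin-used σ u = ∈-tabulate (λ k → any? (λ j → σ j ≟F k)) (u , refl)

clique∩independent : {n : ℕ} (H : Graph n) {K A : Subset n} → IsClique H K → Independent H A →
  ∀ {x y} → x ∈ K → y ∈ K → x ∈ A → y ∈ A → x ≡ y
clique∩independent H clique indep {x} {y} xK yK xA yA with x ≟F y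
... | yes x≡y = x≡y
... | no  x≢y = ⊥-elim (indep xA yA (clique xK yK x≢y))

independent-union : {n d : ℕ} (Gs : Fin d → Graph n) {A : Subset n} →
  (∀ i → Independent (Gs i) A) → Independent (unionGraph Gs) A
independent-union Gs indep xA yA (i , edge) = indep i xA yA edge

bin-independent : {n d : ℕ} (I : VPInstance n d) (Gs : Fin d → Graph n) →
  (∀ i → Equivalent (VPInstance.size I i) (Gs i)) →
  ∀ {σ} → Feasible I σ → ∀ k → Independent (unionGraph Gs) (binContent σ k)
bin-independent I Gs equiv {σ} feasible k =
  independent-union Gs (λ i → Equivalence.to (equiv i (binContent σ k)) (feasible k i))

packing-injectiveOn-clique : {n d : ℕ} (I : VPInstance n d) (Gs : Fin d → Graph n) →
  (∀ i → Equivalent (VPInstance.size I i) (Gs i)) →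
  ∀ {σ K} → Feasible I σ → IsClique (unionGraph Gs) K → InjectiveOn σ K
packing-injectiveOn-clique I Gs equiv {σ} feasible clique {x} {y} xK yK σx≡σy =
  clique∩independent (unionGraph Gs) clique (bin-independent I Gs equiv feasible (σ y))
    xK yK (subst (λ k → x ∈ binContent σ k) σx≡σy (∈-ownBin σ x)) (∈-ownBin σ y)

theorem4p33 : {n d : ℕ} (I : VPInstance n d) (Gs : Fin d → Graph n) →
    (∀ i → Equivalent (VPInstance.size I i) (Gs i)) →
    ∀ opt w → IsOPT I opt → IsCliqueNumber (unionGraph Gs) w → w ≤ opt
theorem4p33 I Gs equiv opt w ((σ , feasible , σ-uses-opt) , _) ((K , clique , ∣K∣≡w) , _) =
  subst₂ _≤_ ∣K∣≡w σ-uses-opt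
    (pigeonhole K (usedBins σ) σ (λ {x} _ → ownBin-used σ x)
      (packing-injectiveOn-clique I Gs equiv feasible clique))
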